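{- For each positive integer $n$, the age of $n*I_\omega^*$ has the expansion property relative to the age of $n*I_\omega$.
   Context: In a directed graph, write $x\perp y$ iff neither $(x,y)$ nor $(y,x)$ is an edge. A complete $n$-partite directed graph is one in which $\perp$ is an equivalence relation with at most $n$ classes (parts). $n*I_\omega$ is the Fraïssé limit of the class of finite complete $n$-partite directed graphs. $n*I_\omega^*$ is the expansion by unary predicates $P_0,\dots,P_{n-1}$ naming the parts and a linear order $<$ convex with respect to the parts with $P_0<\dots<P_{n-1}$; its age consists of all finite $(A,E,P_0,\dots,P_{n-1},<)$ with $(A,E)$ complete $n$-partite whose parts are the nonempty $P_i$'s and $<$ a linear order with $P_0<\dots<P_{n-1}$. If $\mathcal K^*$ is a class of expansions of members of $\mathcal K$, it has the expansion property relative to $\mathcal K$ if for every $\mathbf A\in\mathcal K$ there is $\mathbf B\in\mathcal K$ such that every expansion of $\mathbf A$ in $\mathcal K^*$ embeds in every expansion of $\mathbf B$ in $\mathcal K^*$. -}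

module Defs where

open import Data.Nat using (ℕ; suc)
open import Data.Fin using (Fin) renaming (_<_ to _<ᶠ_)
open import Data.Bool using (Bool; true; false)
open import Data.Product using (Σ; _×_; ∃; ∃-syntax)
open import Data.Sum using (_⊎_)
open import Relation.Nullary using (¬_)
open import Relation.Binary.PropositionalEquality using (_≡_; _≢_)
open import Relation.Binary.Structures using (IsEquivalence)
open import Function.Definitions using (Injective)

record Digraph (m : ℕ) : Set where
  field
    E        : Fin m → Fin m → Bool
    irrefl   : ∀ x → E x x ≡ false
    asym     : ∀ x y → E x y ≡ true → E y x ≡ false

open Digraph public

_⊥[_]_ : ∀ {m} → Fin m → Digraph m → Fin m → Set
x ⊥[ G ] y = (E G x y ≡ false) × (E G y x ≡ false)

-- ⊥ is an equivalence relation with at most n classes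
-- ("at most n classes": among any n+1 vertices two are ⊥-related).
IsCompleteMultipartite : (n : ℕ) → ∀ {m} → Digraph m → Set
IsCompleteMultipartite n {m} G =
  IsEquivalence (λ x y → x ⊥[ G ] y) ×
  ((g : Fin (suc n) → Fin m) → ∃[ i ] ∃[ j ] (i ≢ j × g i ⊥[ G ] g j))

-- An expansion of G in the age of n*I_ω^*: unary predicates P_0,…,P_{n-1}
-- (encoded as the function `part`, x ∈ P_i iff part x ≡ i) whose nonempty
-- members are exactly the ⊥-classes, and a strict linear order `lt`
-- with P_0 < … < P_{n-1}.
record Expansion (n : ℕ) {m : ℕ} (G : Digraph m) : Set where
  field
    part      : Fin m → Fin n
    parts-⊥   : ∀ x y → (x ⊥[ G ] y → part x ≡ part y) × (part x ≡ part y → x ⊥[ G ] y)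
    lt        : Fin m → Fin m → Bool
    lt-irrefl : ∀ x → lt x x ≡ false
    lt-trans  : ∀ x y z → lt x y ≡ true → lt y z ≡ true → lt x z ≡ true
    lt-total  : ∀ x y → x ≢ y → (lt x y ≡ true) ⊎ (lt y x ≡ true)
    convex    : ∀ x y → part x <ᶠ part y → lt x y ≡ true

open Expansion public

Embeds : ∀ {n a b} {A : Digraph a} {B : Digraph b} →
         Expansion n A → Expansion n B → Set
Embeds {n} {a} {b} {A} {B} A* B* =
  Σ (Fin a → Fin b) λ f →
    Injective _≡_ _≡_ f ×
    (∀ x y → E B (f x) (f y) ≡ E A x y) ×
    (∀ x → part B* (f x) ≡ part A* x) ×
    (∀ x y → lt B* (f x) (f y) ≡ lt A* x y)

module Submission where

-- B has one level per part. A vertex of a level is a set S of vertices of the lower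
-- levels, written in binary, together with a copy index; it has an edge to the members of S
-- and receives an edge from the other lower vertices. An expansion of A is embedded into an
-- expansion of B top level first. The order of B* inside the top level is arbitrary, so
-- instead of searching the copies of a given neighbourhood we fix, from a colouring of the
-- lower levels, candidates: candidate i is the top vertex whose S consists of the lower
-- vertices whose colour has bit i set. Each top vertex of A gets the candidate of the rank
-- it needs, and the lower levels are then embedded recursively with prescribed colours,
-- which encode the candidates each image must be adjacent to. The recursion goes through
-- because the colouring of B does not depend on the colours to be realised.

open import Defs
open import Data.Bool.Base using (Bool; true; false; not)
open import Data.Bool.Properties using () renaming (_≟_ to _≟ᵇ_)
open import Data.Empty using (⊥-elim)
open import Data.Fin.Base using (Fin; zero; suc; toℕ; fromℕ<; punchOut) renaming (_<_ to _<ᶠ_)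
open import Data.Fin.Properties
  using (toℕ-injective; toℕ<n; toℕ-fromℕ<; fromℕ<-toℕ; fromℕ<-injective; pigeonhole; any?; punchOut-injective)
  renaming (_≟_ to _≟ᶠ_; <-cmp to <ᶠ-cmp)
open import Data.Fin.Subset using (Subset; _∈_; _⊂_; ⊤; ∣_∣)
open import Data.Fin.Subset.Properties using (p⊂q⇒∣p∣<∣q∣; ∈⊤; ⊆⊤; ∣⊤∣≡n)
open import Data.Maybe.Base using (Maybe; just; nothing)
open import Data.Nat.Base
open import Data.Nat.DivMod
open import Data.Nat.Properties
open import Data.Product.Base using (Σ; ∃; ∃-syntax; _×_; _,_; proj₁; proj₂)
open import Data.Sum.Base using (_⊎_; inj₁; inj₂)
open import Data.Vec.Base using (tabulate)
open import Data.Vec.Properties using (lookup∘tabulate; []=⇒lookup; lookup⇒[]=)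
open import Function.Base using (_∘_)
open import Function.Definitions using (Injective; StrictlySurjective)
open import Relation.Binary.Definitions using (tri<; tri≈; tri>)
open import Relation.Binary.PropositionalEquality
open import Relation.Binary.Structures using (IsEquivalence)
open import Relation.Nullary using (Dec; yes; no; ¬_; does; _×-dec_; contradiction)

-- Binary digits

odd : ℕ → Bool
odd zero          = false
odd (suc zero)    = true
odd (suc (suc x)) = odd x

bit : ℕ → ℕ → Bool
bit zero    x = odd x
bit (suc i) x = bit i ⌊ x /2⌋

odd-+-double : ∀ x y → odd (x + (y + y)) ≡ odd x
odd-+-double x zero    = cong odd (+-identityʳ x)
odd-+-double x (suc y) rewrite +-suc y y | +-suc x (suc (y + y)) | +-suc x (y + y) = odd-+-double x y

⌊+double/2⌋ : ∀ x y → ⌊ x + (y + y) /2⌋ ≡ ⌊ x /2⌋ + y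
⌊+double/2⌋ x zero    rewrite +-identityʳ x = sym (+-identityʳ ⌊ x /2⌋)
⌊+double/2⌋ x (suc y) rewrite +-suc y y | +-suc x (suc (y + y)) | +-suc x (y + y) | +-suc ⌊ x /2⌋ y =
  cong suc (⌊+double/2⌋ x y)

*2^suc : ∀ c N → c * 2 ^ suc N ≡ c * 2 ^ N + c * 2 ^ N
*2^suc c N = begin
  c * (2 * 2 ^ N)       ≡⟨ cong (c *_) (cong (2 ^ N +_) (+-identityʳ (2 ^ N))) ⟩
  c * (2 ^ N + 2 ^ N)   ≡⟨ *-distribˡ-+ c (2 ^ N) (2 ^ N) ⟩
  c * 2 ^ N + c * 2 ^ N ∎
  where open ≡-Reasoning

bit-+-*2^ : ∀ {i N} x c → i < N → bit i (x + c * 2 ^ N) ≡ bit i x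
bit-+-*2^ {zero}  {suc N} x c _ rewrite *2^suc c N = odd-+-double x (c * 2 ^ N)
bit-+-*2^ {suc i} {suc N} x c (s≤s i<N) rewrite *2^suc c N | ⌊+double/2⌋ x (c * 2 ^ N) =
  bit-+-*2^ ⌊ x /2⌋ c i<N

consBit : Bool → ℕ → ℕ
consBit false x = x + x
consBit true  x = suc (x + x)

odd-consBit : ∀ b x → odd (consBit b x) ≡ b
odd-consBit false x = odd-+-double 0 x
odd-consBit true  x = odd-+-double 1 x

⌊consBit/2⌋ : ∀ b x → ⌊ consBit b x /2⌋ ≡ x
⌊consBit/2⌋ false x = ⌊+double/2⌋ 0 x
⌊consBit/2⌋ true  x = ⌊+double/2⌋ 1 x

consBit-< : ∀ b {x y} → x < y → consBit b x < y + y
consBit-< false x<y = +-mono-< x<y x<y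
consBit-< true  {x} {y} x<y = subst (_≤ y + y) (cong suc (+-suc x x)) (+-mono-≤ x<y x<y)

encode : ℕ → (ℕ → Bool) → ℕ
encode zero    b = 0
encode (suc N) b = consBit (b 0) (encode N (b ∘ suc))

bit-encode : ∀ {i N} b → i < N → bit i (encode N b) ≡ b i
bit-encode {zero}  {suc N} b _ = odd-consBit (b 0) _
bit-encode {suc i} {suc N} b (s≤s i<N) rewrite ⌊consBit/2⌋ (b 0) (encode N (b ∘ suc)) =
  bit-encode (b ∘ suc) i<N

encode< : ∀ N b → encode N b < 2 ^ N
encode< zero    b = s≤s z≤n
encode< (suc N) b = subst (encode (suc N) b <_) (cong (2 ^ N +_) (sym (+-identityʳ (2 ^ N))))
  (consBit-< (b 0) (encode< N (b ∘ suc)))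

module _ {m n : ℕ} .{{_ : NonZero n}} (m<n : m < n) where

  [m+kn]%n≡m : ∀ k → (m + k * n) % n ≡ m
  [m+kn]%n≡m k = trans ([m+kn]%n≡m%n m k n) (m<n⇒m%n≡m m<n)

  [m+kn]/n≡k : ∀ k → (m + k * n) / n ≡ k
  [m+kn]/n≡k k = begin
    (m + k * n) / n     ≡⟨ +-distrib-/ m (k * n) digits<n ⟩
    m / n + k * n / n   ≡⟨ cong₂ _+_ (m<n⇒m/n≡0 m<n) (m*n/n≡m k n) ⟩
    k                   ∎
    where
    open ≡-Reasoning
    digits<n : m % n + k * n % n < n
    digits<n = subst (_< n) (sym (trans (cong₂ _+_ (m<n⇒m%n≡m m<n) (m*n%n≡0 k n)) (+-identityʳ m))) m<n

  m+kn<jn : ∀ {k j} → k < j → m + k * n < j * n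
  m+kn<jn {k} {j} k<j = begin-strict
    m + k * n   <⟨ +-monoˡ-< (k * n) m<n ⟩
    suc k * n   ≤⟨ *-monoˡ-≤ n k<j ⟩
    j * n       ∎
    where open ≤-Reasoning

  m+kn<m′+jn : ∀ m′ {k j} → k < j → m + k * n < m′ + j * n
  m+kn<m′+jn m′ {j = j} k<j = <-≤-trans (m+kn<jn k<j) (m≤n+m (j * n) m′)

missing-value⇒¬injective : ∀ {n} {f : Fin n → Fin n} (y : Fin n) →
  (∀ x → f x ≢ y) → ¬ Injective _≡_ _≡_ f
missing-value⇒¬injective {suc n} {f} y y∉image f-inj =
  let i , j , i<j , squeeze-i≡j = pigeonhole (n<1+n n) (punchOut ∘ y≢f)
  in <-irrefl (cong toℕ (f-inj (punchOut-injective (y≢f i) (y≢f j) squeeze-i≡j))) i<j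
  where
  y≢f : ∀ x → y ≢ f x
  y≢f x y≡fx = y∉image x (sym y≡fx)

injective⇒strictlySurjective : ∀ {n} {f : Fin n → Fin n} →
  Injective _≡_ _≡_ f → StrictlySurjective _≡_ f
injective⇒strictlySurjective {f = f} f-inj y with any? (λ x → f x ≟ᶠ y)
... | yes y∈image = y∈image
... | no  y∉image = ⊥-elim (missing-value⇒¬injective y (λ x fx≡y → y∉image (x , fx≡y)) f-inj)

-- Strict orders and ranks

record IsStrictOrderᵇ {X : Set} (lt : X → X → Bool) : Set where
  field
    irreflexive : ∀ x → lt x x ≡ false
    transitive  : ∀ x y z → lt x y ≡ true → lt y z ≡ true → lt x z ≡ true

  asymmetric : ∀ x y → lt x y ≡ true → lt y x ≡ false
  asymmetric x y x<y with lt y x in y<x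
  ... | false = refl
  ... | true with trans (sym (irreflexive x)) (transitive x y x x<y y<x)
  ...   | ()

pullback-strict : {X Y : Set} (g : X → Y) {lt : Y → Y → Bool} →
  IsStrictOrderᵇ lt → IsStrictOrderᵇ (λ x y → lt (g x) (g y))
pullback-strict g strict = record
  { irreflexive = λ x → irreflexive (g x)
  ; transitive  = λ x y z → transitive (g x) (g y) (g z)
  }
  where open IsStrictOrderᵇ strict

Totalᵇ : {X : Set} → (X → X → Bool) → Set
Totalᵇ {X} lt = ∀ (x y : X) → x ≢ y → lt x y ≡ true ⊎ lt y x ≡ true

module _ {X Y : Set} {ltX : X → X → Bool} {ltY : Y → Y → Bool}
         (strictX : IsStrictOrderᵇ ltX) (totalX : Totalᵇ ltX) (strictY : IsStrictOrderᵇ ltY) where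
  private
    module X = IsStrictOrderᵇ strictX
    module Y = IsStrictOrderᵇ strictY

  preserving⇒reflecting : (g : X → Y) {x y : X} → Dec (x ≡ y) →
    (ltX x y ≡ true → ltY (g x) (g y) ≡ true) → (ltX y x ≡ true → ltY (g y) (g x) ≡ true) →
    ltY (g x) (g y) ≡ ltX x y
  preserving⇒reflecting g {x} (yes refl) _ _ = trans (Y.irreflexive (g x)) (sym (X.irreflexive x))
  preserving⇒reflecting g {x} {y} (no x≢y) x<y⇒ y<x⇒ with totalX x y x≢y
  ... | inj₁ x<y = trans (x<y⇒ x<y) (sym x<y)
  ... | inj₂ y<x = trans (Y.asymmetric _ _ (y<x⇒ y<x)) (sym (X.asymmetric y x y<x))

module _ {X : Set} (lt : X → X → Bool) where

  liftMaybe : Maybe X → Maybe X → Bool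
  liftMaybe (just x) (just y) = lt x y
  liftMaybe _        _        = false

  liftMaybe-strict : IsStrictOrderᵇ lt → IsStrictOrderᵇ liftMaybe
  liftMaybe-strict strict = record { irreflexive = irrefl′ ; transitive = trans′ }
    where
    open IsStrictOrderᵇ strict
    irrefl′ : ∀ x → liftMaybe x x ≡ false
    irrefl′ (just x) = irreflexive x
    irrefl′ nothing  = refl
    trans′ : ∀ x y z → liftMaybe x y ≡ true → liftMaybe y z ≡ true → liftMaybe x z ≡ true
    trans′ (just x) (just y) (just z) = transitive x y z
    trans′ (just x) (just y) nothing  _ ()
    trans′ (just x) nothing  _        ()
    trans′ nothing  _        _        ()

module OnNaturals {b : ℕ} {lt : Fin b → Fin b → Bool} (strict : IsStrictOrderᵇ lt) (total : Totalᵇ lt) where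

  toFin : ℕ → Maybe (Fin b)
  toFin u with u <? b
  ... | yes u<b = just (fromℕ< u<b)
  ... | no  _   = nothing

  toFin-< : ∀ {u} (u<b : u < b) → toFin u ≡ just (fromℕ< u<b)
  toFin-< {u} u<b with u <? b
  ... | yes _   = refl
  ... | no u≮b = ⊥-elim (u≮b u<b)

  ltℕ : ℕ → ℕ → Bool
  ltℕ u v = liftMaybe lt (toFin u) (toFin v)

  ltℕ-strict : IsStrictOrderᵇ ltℕ
  ltℕ-strict = pullback-strict toFin (liftMaybe-strict lt strict)

  ltℕ-total : ∀ u v → u < b → v < b → u ≢ v → ltℕ u v ≡ true ⊎ ltℕ v u ≡ true
  ltℕ-total u v u<b v<b u≢v rewrite toFin-< u<b | toFin-< v<b =
    total _ _ (u≢v ∘ fromℕ<-injective u v u<b v<b)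

  ltℕ-toℕ : ∀ i j → ltℕ (toℕ i) (toℕ j) ≡ lt i j
  ltℕ-toℕ i j rewrite toFin-< (toℕ<n i) | toFin-< (toℕ<n j)
                    | fromℕ<-toℕ i (toℕ<n i) | fromℕ<-toℕ j (toℕ<n j) = refl

module Rank {N : ℕ} {lt : Fin N → Fin N → Bool}
            (strict : IsStrictOrderᵇ lt) (total : Totalᵇ lt) where
  open IsStrictOrderᵇ strict

  below : Fin N → Subset N
  below j = tabulate (λ i → lt i j)

  ∈-below⁺ : ∀ {i j} → lt i j ≡ true → i ∈ below j
  ∈-below⁺ {i} {j} i<j = lookup⇒[]= i (below j) (trans (lookup∘tabulate _ i) i<j)

  ∈-below⁻ : ∀ {i j} → i ∈ below j → lt i j ≡ true
  ∈-below⁻ {i} i∈ = trans (sym (lookup∘tabulate _ i)) ([]=⇒lookup i∈)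

  ∉-below-self : ∀ j → ¬ j ∈ below j
  ∉-below-self j j∈ with trans (sym (irreflexive j)) (∈-below⁻ j∈)
  ... | ()

  below-⊂ : ∀ {i j} → lt i j ≡ true → below i ⊂ below j
  below-⊂ {i} i<j = (λ k∈ → ∈-below⁺ (transitive _ _ _ (∈-below⁻ k∈) i<j)) ,
                    i , ∈-below⁺ i<j , ∉-below-self i

  ∣below∣<N : ∀ j → ∣ below j ∣ < N
  ∣below∣<N j = subst (∣ below j ∣ <_) (∣⊤∣≡n N) (p⊂q⇒∣p∣<∣q∣ (⊆⊤ , j , ∈⊤ , ∉-below-self j))

  rank : Fin N → Fin N
  rank j = fromℕ< (∣below∣<N j)

  rank-mono : ∀ {i j} → lt i j ≡ true → rank i <ᶠ rank j
  rank-mono i<j = subst₂ _<_ (sym (toℕ-fromℕ< _)) (sym (toℕ-fromℕ< _)) (p⊂q⇒∣p∣<∣q∣ (below-⊂ i<j))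

  rank-reflects : ∀ {i j} → rank i <ᶠ rank j → lt i j ≡ true
  rank-reflects {i} {j} ri<rj with i ≟ᶠ j
  ... | yes refl = ⊥-elim (<-irrefl refl ri<rj)
  ... | no i≢j with total i j i≢j
  ...   | inj₁ i<j = i<j
  ...   | inj₂ j<i = ⊥-elim (<-asym ri<rj (rank-mono j<i))

  rank-injective : Injective _≡_ _≡_ rank
  rank-injective {i} {j} ri≡rj with i ≟ᶠ j
  ... | yes i≡j = i≡j
  ... | no i≢j with total i j i≢j
  ...   | inj₁ i<j = ⊥-elim (<⇒≢ (rank-mono i<j) (cong toℕ ri≡rj))
  ...   | inj₂ j<i = ⊥-elim (<⇒≢ (rank-mono j<i) (cong toℕ (sym ri≡rj)))

  rank-surjective : StrictlySurjective _≡_ rank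
  rank-surjective = injective⇒strictlySurjective rank-injective

-- The universal graph

module Universal (k : ℕ) .{{_ : NonZero k}} where

  grow : ℕ → ℕ
  grow T = 2 ^ (k * T) * T

  grow-nonZero : ∀ T .{{_ : NonZero T}} → NonZero (grow T)
  grow-nonZero T = m*n≢0 (2 ^ (k * T)) T {{m^n≢0 2 (k * T)}}

  size : ℕ → ℕ → ℕ
  size zero    T = 0
  size (suc m) T = size m (grow T) + k * T * 2 ^ size m (grow T)

  -- With L = size m (grow T), the top level of size (suc m) T consists of the vertices
  -- L + (h + i * 2 ^ L) with h < 2 ^ L, read as a set of lower vertices, and a copy
  -- index i < k * T.
  edge : ℕ → ℕ → ℕ → ℕ → Bool
  edge zero    T u v = false
  edge (suc m) T u v with u <? size m (grow T) | v <? size m (grow T)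
  ... | yes _ | yes _ = edge m (grow T) u v
  ... | yes _ | no  _ = not (bit u (v ∸ size m (grow T)))
  ... | no  _ | yes _ = bit v (u ∸ size m (grow T))
  ... | no  _ | no  _ = false

  level : ℕ → ℕ → ℕ → ℕ
  level zero    T u = 0
  level (suc m) T u with u <? size m (grow T)
  ... | yes _ = level m (grow T) u
  ... | no  _ = m

  edge-irrefl : ∀ m T u → edge m T u u ≡ false
  edge-irrefl zero    T u = refl
  edge-irrefl (suc m) T u with u <? size m (grow T)
  ... | yes _ = edge-irrefl m (grow T) u
  ... | no  _ = refl

  edge-asym : ∀ m T u v → edge m T u v ≡ true → edge m T v u ≡ false
  edge-asym (suc m) T u v uv with u <? size m (grow T) | v <? size m (grow T)
  ... | yes _ | yes _ = edge-asym m (grow T) u v uv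
  ... | yes _ | no  _ with bit u (v ∸ size m (grow T))
  ...   | false = refl
  edge-asym (suc m) T u v () | yes _ | no _ | true
  edge-asym (suc m) T u v uv | no _ | yes _ with bit v (u ∸ size m (grow T))
  ...   | true = refl
  edge-asym (suc m) T u v () | no _ | yes _ | false
  edge-asym (suc m) T u v () | no _ | no _

  level< : ∀ m T u → u < size m T → level m T u < m
  level< (suc m) T u u< with u <? size m (grow T)
  ... | yes u<L = m≤n⇒m≤1+n (level< m (grow T) u u<L)
  ... | no  _   = ≤-refl

  non-adjacent⇒same-level : ∀ m T u v → u < size m T → v < size m T →
    edge m T u v ≡ false → edge m T v u ≡ false → level m T u ≡ level m T v
  non-adjacent⇒same-level (suc m) T u v u< v< uv vu
    with u <? size m (grow T) | v <? size m (grow T)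
  ... | yes u<L | yes v<L = non-adjacent⇒same-level m (grow T) u v u<L v<L uv vu
  ... | no  _   | no  _   = refl
  ... | yes _   | no  _ with bit u (v ∸ size m (grow T))
  non-adjacent⇒same-level (suc m) T u v u< v< () vu | yes _ | no _ | false
  non-adjacent⇒same-level (suc m) T u v u< v< uv () | yes _ | no _ | true
  non-adjacent⇒same-level (suc m) T u v u< v< uv vu | no _ | yes _ with bit v (u ∸ size m (grow T))
  non-adjacent⇒same-level (suc m) T u v u< v< () vu | no _ | yes _ | true
  non-adjacent⇒same-level (suc m) T u v u< v< uv () | no _ | yes _ | false

  same-level⇒non-adjacent : ∀ m T u v → u < size m T → v < size m T →
    level m T u ≡ level m T v → edge m T u v ≡ false
  same-level⇒non-adjacent (suc m) T u v u< v< same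
    with u <? size m (grow T) | v <? size m (grow T)
  ... | yes u<L | yes v<L = same-level⇒non-adjacent m (grow T) u v u<L v<L same
  ... | yes u<L | no  _   = ⊥-elim (<⇒≢ (level< m (grow T) u u<L) same)
  ... | no  _   | yes v<L = ⊥-elim (<⇒≢ (level< m (grow T) v v<L) (sym same))
  ... | no  _   | no  _   = refl

  module _ (m T : ℕ) where
    private
      L = size m (grow T)

    edge-low-low : ∀ {u v} → u < L → v < L → edge (suc m) T u v ≡ edge m (grow T) u v
    edge-low-low {u} {v} u<L v<L with u <? L | v <? L
    ... | yes _ | yes _   = refl
    ... | no u≮L | _      = ⊥-elim (u≮L u<L)
    ... | yes _ | no v≮L  = ⊥-elim (v≮L v<L)

    edge-low-top : ∀ {u v} → u < L → ¬ v < L → edge (suc m) T u v ≡ not (bit u (v ∸ L))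
    edge-low-top {u} {v} u<L v≮L with u <? L | v <? L
    ... | yes _ | no _    = refl
    ... | no u≮L | _      = ⊥-elim (u≮L u<L)
    ... | yes _ | yes v<L = ⊥-elim (v≮L v<L)

    edge-top-low : ∀ {u v} → ¬ u < L → v < L → edge (suc m) T u v ≡ bit v (u ∸ L)
    edge-top-low {u} {v} u≮L v<L with u <? L | v <? L
    ... | no _ | yes _    = refl
    ... | yes u<L | _     = ⊥-elim (u≮L u<L)
    ... | no _ | no v≮L   = ⊥-elim (v≮L v<L)

    edge-top-top : ∀ {u v} → ¬ u < L → ¬ v < L → edge (suc m) T u v ≡ false
    edge-top-top {u} {v} u≮L v≮L with u <? L | v <? L
    ... | no _ | no _     = refl
    ... | yes u<L | _     = ⊥-elim (u≮L u<L)
    ... | no _ | yes v<L  = ⊥-elim (v≮L v<L)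

    level-low : ∀ {u} → u < L → level (suc m) T u ≡ level m (grow T) u
    level-low {u} u<L with u <? L
    ... | yes _   = refl
    ... | no u≮L  = ⊥-elim (u≮L u<L)

    level-top : ∀ {u} → ¬ u < L → level (suc m) T u ≡ m
    level-top {u} u≮L with u <? L
    ... | yes u<L = ⊥-elim (u≮L u<L)
    ... | no _    = refl

  edge-low-top-flip : ∀ m T {u v} → u < size m (grow T) → ¬ v < size m (grow T) →
    edge (suc m) T u v ≡ not (edge (suc m) T v u)
  edge-low-top-flip m T u<L v≮L =
    trans (edge-low-top m T u<L v≮L) (cong not (sym (edge-top-low m T v≮L u<L)))

  level-inhabited : ∀ m T .{{_ : NonZero T}} q → q < m → ∃ λ v → v < size m T × level m T v ≡ q
  level-inhabited (suc m) T q q<1+m with m≤n⇒m<n∨m≡n (s≤s⁻¹ q<1+m)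
  ... | inj₁ q<m =
    let v , v<L , level≡q = level-inhabited m (grow T) {{grow-nonZero T}} q q<m
    in v , <-≤-trans v<L (m≤m+n _ _) , trans (level-low m T v<L) level≡q
  ... | inj₂ refl = L , L<size , level-top m T (<-irrefl refl)
    where
    L = size m (grow T)
    L<size : L < size (suc m) T
    L<size = subst (_≤ size (suc m) T) (+-comm L 1)
                   (+-monoʳ-≤ L (>-nonZero⁻¹ (k * T * 2 ^ L) {{m*n≢0 (k * T) (2 ^ L) {{m*n≢0 k T}} {{m^n≢0 2 L}}}}))

-- Embedding level by level

module Embedding {a : ℕ} (A : Digraph a)
  {ltA : Fin a → Fin a → Bool} (ltA-strict : IsStrictOrderᵇ ltA) (ltA-total : Totalᵇ ltA)
  -- π x is the level of B that receives x.
  (π : Fin a → ℕ)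
  (π-same : ∀ x y → π x ≡ π y → E A x y ≡ false)
  (π-diff : ∀ x y → π x ≢ π y → E A x y ≡ not (E A y x))
  (b : ℕ) {lt : ℕ → ℕ → Bool} (lt-strict : IsStrictOrderᵇ lt)
  (lt-total : ∀ u v → u < b → v < b → u ≢ v → lt u v ≡ true ⊎ lt v u ≡ true)
  where

  open Universal (suc a)
  module RankA = Rank ltA-strict ltA-total

  r : Fin a → ℕ
  r x = toℕ (RankA.rank x)

  r<k : ∀ x → r x < suc a
  r<k x = m≤n⇒m≤1+n (toℕ<n (RankA.rank x))

  record LevelEmbedding (m T : ℕ) (χ : ℕ → ℕ) (τ : Fin a → ℕ) (f : Fin a → ℕ) : Set where
    field
      bounded           : ∀ x → π x < m → f x < size m T
      level-preserving  : ∀ x → π x < m → level m T (f x) ≡ π x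
      colour-preserving : ∀ x → π x < m → χ (f x) ≡ τ x
      edge-preserving   : ∀ x y → π x < m → π y < m → edge m T (f x) (f y) ≡ E A x y
      order-preserving  : ∀ x y → π x < m → π x ≡ π y → ltA x y ≡ true → lt (f x) (f y) ≡ true

  module Step (m T : ℕ) .{{_ : NonZero T}} (size≤b : size (suc m) T ≤ b) (χ′ : ℕ → ℕ)
    (embed′ : ∀ τ → (∀ x → τ x < grow T) → ∃ (LevelEmbedding m (grow T) χ′ τ)) where

    L N P : ℕ
    L = size m (grow T)
    N = suc a * T
    P = 2 ^ L

    instance
      P-nonZero : NonZero P
      P-nonZero = m^n≢0 2 L

    -- Candidate i sends edges to the lower vertices u with bit i of χ′ u / T set.
    shape : Fin N → ℕ
    shape i = encode L (λ u → bit (toℕ i) (χ′ u / T))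

    candidate : Fin N → ℕ
    candidate i = L + (shape i + toℕ i * P)

    candidate-top : ∀ i → ¬ candidate i < L
    candidate-top i = ≤⇒≯ (m≤m+n L _)

    candidate∸L : ∀ i → candidate i ∸ L ≡ shape i + toℕ i * P
    candidate∸L i = m+n∸m≡n L _

    candidate<size : ∀ i → candidate i < size (suc m) T
    candidate<size i = +-monoʳ-< L (m+kn<jn {n = P} (encode< L _) (toℕ<n i))

    candidate-injective : Injective _≡_ _≡_ candidate
    candidate-injective {i} {j} ci≡cj = toℕ-injective (begin
      toℕ i                       ≡⟨ [m+kn]/n≡k {n = P} (encode< L _) (toℕ i) ⟨
      (shape i + toℕ i * P) / P   ≡⟨ cong (_/ P) (+-cancelˡ-≡ L _ _ ci≡cj) ⟩
      (shape j + toℕ j * P) / P   ≡⟨ [m+kn]/n≡k {n = P} (encode< L _) (toℕ j) ⟩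
      toℕ j                       ∎)
      where open ≡-Reasoning

    candidate-total : Totalᵇ (λ i j → lt (candidate i) (candidate j))
    candidate-total i j i≢j = lt-total _ _ (<-≤-trans (candidate<size i) size≤b)
      (<-≤-trans (candidate<size j) size≤b) (i≢j ∘ candidate-injective)

    open Rank (pullback-strict candidate lt-strict) candidate-total
      using (rank; rank-reflects; rank-surjective)

    -- χ′ u / T went into the shapes; χ′ u % T is the colour of a lower vertex at this
    -- level. A top vertex is coloured by its rank among the candidates.
    colour : ℕ → ℕ
    colour v with v <? L
    ... | yes _ = χ′ v % T
    ... | no  _ = ∣ tabulate (λ j → lt (candidate j) v) ∣ % T

    colour-low : ∀ {v} → v < L → colour v ≡ χ′ v % T
    colour-low {v} v<L with v <? L
    ... | yes _  = refl
    ... | no v≮L = ⊥-elim (v≮L v<L)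

    colour-candidate : ∀ i → colour (candidate i) ≡ toℕ (rank i) % T
    colour-candidate i with candidate i <? L
    ... | yes ci<L = ⊥-elim (candidate-top i ci<L)
    ... | no _     = cong (_% T) (sym (toℕ-fromℕ< _))

    module Target (τ : Fin a → ℕ) (τ<T : ∀ x → τ x < T) where

      -- The candidate of rank R x has colour τ x, and R increases along the order of A.
      R : Fin a → ℕ
      R x = τ x + r x * T

      index : Fin a → Fin N
      index x = proj₁ (rank-surjective (fromℕ< (m+kn<jn (τ<T x) (r<k x))))

      rank-index : ∀ x → toℕ (rank (index x)) ≡ R x
      rank-index x = trans (cong toℕ (proj₂ (rank-surjective _))) (toℕ-fromℕ< _)

      index-injective : Injective _≡_ _≡_ index
      index-injective {x} {y} ix≡iy = RankA.rank-injective (toℕ-injective (begin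
        r x                        ≡⟨ [m+kn]/n≡k (τ<T x) (r x) ⟨
        R x / T                    ≡⟨ cong (_/ T) (rank-index x) ⟨
        toℕ (rank (index x)) / T   ≡⟨ cong (λ i → toℕ (rank i) / T) ix≡iy ⟩
        toℕ (rank (index y)) / T   ≡⟨ cong (_/ T) (rank-index y) ⟩
        R y / T                    ≡⟨ [m+kn]/n≡k (τ<T y) (r y) ⟩
        r y                        ∎))
        where open ≡-Reasoning

      edgeFrom? : ∀ y i x → Dec (π x ≡ m × toℕ (index x) ≡ i × E A x y ≡ true)
      edgeFrom? y i x = (π x ≟ m) ×-dec (toℕ (index x) ≟ i) ×-dec (E A x y ≟ᵇ true)

      edgeFromIndex : Fin a → ℕ → Bool
      edgeFromIndex y i = does (any? (edgeFrom? y i))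

      edgeFromIndex-index : ∀ x y → π x ≡ m → edgeFromIndex y (toℕ (index x)) ≡ E A x y
      edgeFromIndex-index x y πx≡m with any? (edgeFrom? y (toℕ (index x)))
      ... | yes (x′ , _ , ix′≡ix , Ex′y≡true) =
        trans (sym Ex′y≡true) (cong (λ z → E A z y) (index-injective (toℕ-injective ix′≡ix)))
      ... | no none with E A x y in Exy
      ...   | false = refl
      ...   | true  = ⊥-elim (none (x , πx≡m , refl , Exy))

      τ′ : Fin a → ℕ
      τ′ y = τ y + encode N (edgeFromIndex y) * T

      τ′<grow : ∀ y → τ′ y < grow T
      τ′<grow y = m+kn<jn (τ<T y) (encode< N (edgeFromIndex y))

      f′ : Fin a → ℕ
      f′ = proj₁ (embed′ τ′ τ′<grow)

      open LevelEmbedding (proj₂ (embed′ τ′ τ′<grow)) renaming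
        ( bounded to f′-bounded; level-preserving to f′-level; colour-preserving to f′-colour
        ; edge-preserving to f′-edge; order-preserving to f′-order)

      candidate-edge : ∀ x y → π x ≡ m → π y < m →
        edge (suc m) T (candidate (index x)) (f′ y) ≡ E A x y
      candidate-edge x y πx≡m πy<m = begin
        edge (suc m) T (candidate i) (f′ y)       ≡⟨ edge-top-low m T (candidate-top i) f′y<L ⟩
        bit (f′ y) (candidate i ∸ L)              ≡⟨ cong (bit (f′ y)) (candidate∸L i) ⟩
        bit (f′ y) (shape i + toℕ i * P)          ≡⟨ bit-+-*2^ (shape i) (toℕ i) f′y<L ⟩
        bit (f′ y) (shape i)                      ≡⟨ bit-encode _ f′y<L ⟩
        bit (toℕ i) (χ′ (f′ y) / T)               ≡⟨ cong (λ c → bit (toℕ i) (c / T)) (f′-colour y πy<m) ⟩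
        bit (toℕ i) (τ′ y / T)                    ≡⟨ cong (bit (toℕ i)) ([m+kn]/n≡k (τ<T y) _) ⟩
        bit (toℕ i) (encode N (edgeFromIndex y))  ≡⟨ bit-encode _ (toℕ<n i) ⟩
        edgeFromIndex y (toℕ i)                   ≡⟨ edgeFromIndex-index x y πx≡m ⟩
        E A x y                                   ∎
        where
        open ≡-Reasoning
        i = index x
        f′y<L = f′-bounded y πy<m

      f : Fin a → ℕ
      f x with π x ≟ m
      ... | yes _ = candidate (index x)
      ... | no  _ = f′ x

      private
        below-m : ∀ {x} → π x < suc m → π x ≢ m → π x < m
        below-m πx<1+m πx≢m = ≤∧≢⇒< (s≤s⁻¹ πx<1+m) πx≢m

      f-bounded : ∀ x → π x < suc m → f x < size (suc m) T
      f-bounded x πx<1+m with π x ≟ m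
      ... | yes _    = candidate<size (index x)
      ... | no πx≢m = <-≤-trans (f′-bounded x (below-m πx<1+m πx≢m)) (m≤m+n L _)

      f-level : ∀ x → π x < suc m → level (suc m) T (f x) ≡ π x
      f-level x πx<1+m with π x ≟ m
      ... | yes πx≡m = trans (level-top m T (candidate-top (index x))) (sym πx≡m)
      ... | no πx≢m  = trans (level-low m T (f′-bounded x πx<m)) (f′-level x πx<m)
        where πx<m = below-m πx<1+m πx≢m

      f-colour : ∀ x → π x < suc m → colour (f x) ≡ τ x
      f-colour x πx<1+m with π x ≟ m
      ... | yes _ = begin
        colour (candidate (index x))  ≡⟨ colour-candidate (index x) ⟩
        toℕ (rank (index x)) % T      ≡⟨ cong (_% T) (rank-index x) ⟩
        R x % T                       ≡⟨ [m+kn]%n≡m (τ<T x) (r x) ⟩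
        τ x                           ∎
        where open ≡-Reasoning
      ... | no πx≢m = begin
        colour (f′ x)   ≡⟨ colour-low (f′-bounded x πx<m) ⟩
        χ′ (f′ x) % T   ≡⟨ cong (_% T) (f′-colour x πx<m) ⟩
        τ′ x % T        ≡⟨ [m+kn]%n≡m (τ<T x) (encode N (edgeFromIndex x)) ⟩
        τ x             ∎
        where
        open ≡-Reasoning
        πx<m = below-m πx<1+m πx≢m

      f-edge : ∀ x y → π x < suc m → π y < suc m → edge (suc m) T (f x) (f y) ≡ E A x y
      f-edge x y πx<1+m πy<1+m with π x ≟ m | π y ≟ m
      ... | yes πx≡m | yes πy≡m =
        trans (edge-top-top m T (candidate-top (index x)) (candidate-top (index y)))
              (sym (π-same x y (trans πx≡m (sym πy≡m))))
      ... | yes πx≡m | no πy≢m = candidate-edge x y πx≡m (below-m πy<1+m πy≢m)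
      ... | no πx≢m | yes πy≡m = begin
        edge (suc m) T (f′ x) (candidate (index y))          ≡⟨ edge-low-top-flip m T f′x<L (candidate-top (index y)) ⟩
        not (edge (suc m) T (candidate (index y)) (f′ x))    ≡⟨ cong not (candidate-edge y x πy≡m πx<m) ⟩
        not (E A y x)                                        ≡⟨ π-diff x y (πx≢m ∘ (λ πx≡πy → trans πx≡πy πy≡m)) ⟨
        E A x y                                              ∎
        where
        open ≡-Reasoning
        πx<m = below-m πx<1+m πx≢m
        f′x<L = f′-bounded x πx<m
      ... | no πx≢m | no πy≢m =
        trans (edge-low-low m T (f′-bounded x πx<m) (f′-bounded y πy<m)) (f′-edge x y πx<m πy<m)
        where
        πx<m = below-m πx<1+m πx≢m
        πy<m = below-m πy<1+m πy≢m

      f-order : ∀ x y → π x < suc m → π x ≡ π y → ltA x y ≡ true → lt (f x) (f y) ≡ true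
      f-order x y πx<1+m πx≡πy x<y with π x ≟ m | π y ≟ m
      ... | yes _ | yes _ = rank-reflects {index x} {index y} (subst₂ _<_ (sym (rank-index x)) (sym (rank-index y))
                              (m+kn<m′+jn (τ<T x) (τ y) (RankA.rank-mono x<y)))
      ... | yes πx≡m | no πy≢m = ⊥-elim (πy≢m (trans (sym πx≡πy) πx≡m))
      ... | no πx≢m | yes πy≡m = ⊥-elim (πx≢m (trans πx≡πy πy≡m))
      ... | no πx≢m | no _     = f′-order x y (below-m πx<1+m πx≢m) πx≡πy x<y

      embedding : LevelEmbedding (suc m) T colour τ f
      embedding = record
        { bounded = f-bounded ; level-preserving = f-level ; colour-preserving = f-colour
        ; edge-preserving = f-edge ; order-preserving = f-order }

  levelEmbedding : ∀ m T .{{_ : NonZero T}} → size m T ≤ b →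
    ∃ λ χ → ∀ τ → (∀ x → τ x < T) → ∃ (LevelEmbedding m T χ τ)
  levelEmbedding zero T _ = (λ _ → 0) , λ τ _ → (λ _ → 0) , record
    { bounded = λ _ () ; level-preserving = λ _ () ; colour-preserving = λ _ ()
    ; edge-preserving = λ _ _ () ; order-preserving = λ _ _ () }
  levelEmbedding (suc m) T size≤b =
    let χ′ , embed′ = levelEmbedding m (grow T) {{grow-nonZero T}} (≤-trans (m≤m+n _ _) size≤b)
        open Step m T size≤b χ′ embed′
    in colour , λ τ τ<T → Target.f τ τ<T , Target.embedding τ τ<T

-- Expansions

module _ {n m : ℕ} {G : Digraph m} (G* : Expansion n G) where

  expansion-strict : IsStrictOrderᵇ (lt G*)
  expansion-strict = record { irreflexive = lt-irrefl G* ; transitive = lt-trans G* }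

  same-part⇒non-adjacent : ∀ x y → part G* x ≡ part G* y → E G x y ≡ false
  same-part⇒non-adjacent x y same = proj₁ (proj₂ (parts-⊥ G* x y) same)

  different-parts⇒adjacent : ∀ x y → part G* x ≢ part G* y → E G x y ≡ not (E G y x)
  different-parts⇒adjacent x y different with E G y x in yx
  ... | true = asym G y x yx
  ... | false with E G x y in xy
  ...   | true  = refl
  ...   | false = ⊥-elim (different (proj₁ (parts-⊥ G* x y) (xy , yx)))

  lt-later-part : ∀ x y → part G* y <ᶠ part G* x → lt G* x y ≡ false
  lt-later-part x y later = IsStrictOrderᵇ.asymmetric expansion-strict y x (convex G* y x later)

-- The witness

module Witness (n a : ℕ) where
  open Universal (suc a)

  b : ℕ
  b = size n 1

  B : Digraph b
  B = record
    { E      = λ u v → edge n 1 (toℕ u) (toℕ v)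
    ; irrefl = λ u → edge-irrefl n 1 (toℕ u)
    ; asym   = λ u v → edge-asym n 1 (toℕ u) (toℕ v)
    }

  levelB : Fin b → ℕ
  levelB u = level n 1 (toℕ u)

  ⊥⇒same-level : ∀ u v → u ⊥[ B ] v → levelB u ≡ levelB v
  ⊥⇒same-level u v (uv , vu) = non-adjacent⇒same-level n 1 _ _ (toℕ<n u) (toℕ<n v) uv vu

  same-level⇒⊥ : ∀ u v → levelB u ≡ levelB v → u ⊥[ B ] v
  same-level⇒⊥ u v same = same-level⇒non-adjacent n 1 _ _ (toℕ<n u) (toℕ<n v) same ,
                          same-level⇒non-adjacent n 1 _ _ (toℕ<n v) (toℕ<n u) (sym same)

  B-complete-multipartite : IsCompleteMultipartite n B
  B-complete-multipartite = ⊥-isEquivalence , at-most-n-parts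
    where
    ⊥-isEquivalence : IsEquivalence (λ u v → u ⊥[ B ] v)
    ⊥-isEquivalence = record
      { refl  = λ {u} → same-level⇒⊥ u u refl
      ; sym   = λ { (uv , vu) → vu , uv }
      ; trans = λ {u} {v} {w} u⊥v v⊥w →
          same-level⇒⊥ u w (trans (⊥⇒same-level u v u⊥v) (⊥⇒same-level v w v⊥w))
      }
    at-most-n-parts : (g : Fin (suc n) → Fin b) → ∃[ i ] ∃[ j ] (i ≢ j × g i ⊥[ B ] g j)
    at-most-n-parts g =
      let i , j , i<j , same = pigeonhole (n<1+n n) (λ t → fromℕ< (level< n 1 _ (toℕ<n (g t))))
      in i , j , (λ i≡j → <-irrefl (cong toℕ i≡j) i<j) ,
         same-level⇒⊥ (g i) (g j) (fromℕ<-injective _ _ _ _ same)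

  module _ {A : Digraph a} (A* : Expansion n A) (B* : Expansion n B) where

    same-part⇒same-level : ∀ u v → part B* u ≡ part B* v → levelB u ≡ levelB v
    same-part⇒same-level u v same = ⊥⇒same-level u v (proj₂ (parts-⊥ B* u v) same)

    same-level⇒same-part : ∀ u v → levelB u ≡ levelB v → part B* u ≡ part B* v
    same-level⇒same-part u v same = proj₁ (parts-⊥ B* u v) (same-level⇒⊥ u v same)

    vertexAt : Fin n → Fin b
    vertexAt q = fromℕ< (proj₁ (proj₂ (level-inhabited n 1 (toℕ q) (toℕ<n q))))

    levelB-vertexAt : ∀ q → levelB (vertexAt q) ≡ toℕ q
    levelB-vertexAt q =
      let _ , v<b , level≡q = level-inhabited n 1 (toℕ q) (toℕ<n q)
      in trans (cong (level n 1) (toℕ-fromℕ< v<b)) level≡q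

    labelOf : Fin n → Fin n
    labelOf q = part B* (vertexAt q)

    labelOf-injective : Injective _≡_ _≡_ labelOf
    labelOf-injective {q} {q′} same = toℕ-injective (begin
      toℕ q                  ≡⟨ levelB-vertexAt q ⟨
      levelB (vertexAt q)    ≡⟨ same-part⇒same-level _ _ same ⟩
      levelB (vertexAt q′)   ≡⟨ levelB-vertexAt q′ ⟩
      toℕ q′                 ∎)
      where open ≡-Reasoning

    levelOf : Fin n → Fin n
    levelOf l = proj₁ (injective⇒strictlySurjective labelOf-injective l)

    labelOf-levelOf : ∀ l → labelOf (levelOf l) ≡ l
    labelOf-levelOf l = proj₂ (injective⇒strictlySurjective labelOf-injective l)

    π : Fin a → ℕ
    π x = toℕ (levelOf (part A* x))

    π≡⇒same-part : ∀ x y → π x ≡ π y → part A* x ≡ part A* y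
    π≡⇒same-part x y πx≡πy = begin
      part A* x                     ≡⟨ labelOf-levelOf (part A* x) ⟨
      labelOf (levelOf (part A* x)) ≡⟨ cong labelOf (toℕ-injective πx≡πy) ⟩
      labelOf (levelOf (part A* y)) ≡⟨ labelOf-levelOf (part A* y) ⟩
      part A* y                     ∎
      where open ≡-Reasoning

    open OnNaturals (expansion-strict B*) (lt-total B*)
    open Embedding A (expansion-strict A*) (lt-total A*) π
      (λ x y → same-part⇒non-adjacent A* x y ∘ π≡⇒same-part x y)
      (λ x y πx≢πy → different-parts⇒adjacent A* x y (πx≢πy ∘ cong (toℕ ∘ levelOf)))
      b ltℕ-strict ltℕ-total

    solution : ∃ (LevelEmbedding n 1 _ (λ _ → 0))
    solution = proj₂ (levelEmbedding n 1 ≤-refl) (λ _ → 0) (λ _ → z<s)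

    f : Fin a → ℕ
    f = proj₁ solution

    open LevelEmbedding (proj₂ solution)

    π<n : ∀ x → π x < n
    π<n x = toℕ<n (levelOf (part A* x))

    F : Fin a → Fin b
    F x = fromℕ< (bounded x (π<n x))

    toℕ-F : ∀ x → toℕ (F x) ≡ f x
    toℕ-F x = toℕ-fromℕ< (bounded x (π<n x))

    F-edge : ∀ x y → E B (F x) (F y) ≡ E A x y
    F-edge x y = trans (cong₂ (edge n 1) (toℕ-F x) (toℕ-F y)) (edge-preserving x y (π<n x) (π<n y))

    F-part : ∀ x → part B* (F x) ≡ part A* x
    F-part x = trans (same-level⇒same-part (F x) (vertexAt (levelOf l)) level-F) (labelOf-levelOf l)
      where
      l = part A* x
      level-F : levelB (F x) ≡ levelB (vertexAt (levelOf l))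
      level-F = trans (cong (level n 1) (toℕ-F x))
                      (trans (level-preserving x (π<n x)) (sym (levelB-vertexAt (levelOf l))))

    F-order : ∀ x y → part A* x ≡ part A* y → lt A* x y ≡ true → lt B* (F x) (F y) ≡ true
    F-order x y same x<y =
      trans (sym (ltℕ-toℕ (F x) (F y)))
            (trans (cong₂ ltℕ (toℕ-F x) (toℕ-F y))
                   (order-preserving x y (π<n x) (cong (toℕ ∘ levelOf) same) x<y))

    F-lt : ∀ x y → lt B* (F x) (F y) ≡ lt A* x y
    F-lt x y with part A* x ≟ᶠ part A* y | <ᶠ-cmp (part A* x) (part A* y)
    ... | yes same | _ = preserving⇒reflecting (expansion-strict A*) (lt-total A*) (expansion-strict B*)
                           F (x ≟ᶠ y) (F-order x y same) (F-order y x (sym same))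
    ... | no different | tri≈ _ same _ = ⊥-elim (different same)
    ... | no _ | tri< earlier _ _ =
      trans (convex B* (F x) (F y) (subst₂ _<ᶠ_ (sym (F-part x)) (sym (F-part y)) earlier))
            (sym (convex A* x y earlier))
    ... | no _ | tri> _ _ later =
      trans (lt-later-part B* (F x) (F y) (subst₂ _<ᶠ_ (sym (F-part y)) (sym (F-part x)) later))
            (sym (lt-later-part A* x y later))

    F-collapse⇒lt-false : ∀ x y → F x ≡ F y → lt A* x y ≡ false
    F-collapse⇒lt-false x y Fx≡Fy = begin
      lt A* x y           ≡⟨ F-lt x y ⟨
      lt B* (F x) (F y)   ≡⟨ cong (lt B* (F x)) Fx≡Fy ⟨
      lt B* (F x) (F x)   ≡⟨ lt-irrefl B* (F x) ⟩
      false               ∎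
      where open ≡-Reasoning

    F-injective : Injective _≡_ _≡_ F
    F-injective {x} {y} Fx≡Fy with x ≟ᶠ y
    ... | yes x≡y = x≡y
    ... | no x≢y with lt-total A* x y x≢y
    ...   | inj₁ x<y = contradiction (trans (sym x<y) (F-collapse⇒lt-false x y Fx≡Fy)) λ ()
    ...   | inj₂ y<x = contradiction (trans (sym y<x) (F-collapse⇒lt-false y x (sym Fx≡Fy))) λ ()

    embeds : Embeds A* B*
    embeds = F , F-injective , F-edge , F-part , F-lt

theorem8p7 : (n : ℕ) → 0 < n →
    (a : ℕ) (A : Digraph a) → IsCompleteMultipartite n A →
    Σ ℕ λ b → Σ (Digraph b) λ B → IsCompleteMultipartite n B ×
      ((A* : Expansion n A) (B* : Expansion n B) → Embeds A* B*)
theorem8p7 n _ a A _ = b , B , B-complete-multipartite , embeds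
  where open Witness n a
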